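{- Let $F$ be a finite field and $A$ a proper subgroup of the multiplicative group $F^*$. Then $D_A(F)\ge 3$.
   Context: $F$ is regarded as a module over itself. For $A\subseteq F$, an $A$-weighted zero-sum subsequence of a sequence $(x_1,\ldots,x_k)$ in $F$ is given by a non-empty $I\subseteq[1,k]$ and $a_i\in A$ ($i\in I$) with $\sum_{i\in I}a_ix_i=0$. $D_A(F)$ is the least positive integer $k$ such that every sequence in $F$ of length $k$ has an $A$-weighted zero-sum subsequence. -}

module Defs where

open import Level using (Level; _⊔_)
open import Data.Nat using (ℕ; zero; suc; _≤_)
open import Data.Fin using (Fin; zero; suc)
open import Data.Fin.Subset using (Subset; _∈_; Nonempty; inside; outside)
open import Data.Vec using (_∷_)
open import Data.Product using (Σ; ∃; _×_; _,_)
open import Relation.Nullary using (¬_)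
open import Algebra.Bundles using (CommutativeRing)

record IsFiniteField {c ℓ : Level} (F : CommutativeRing c ℓ) : Set (c ⊔ ℓ) where
  open CommutativeRing F using (Carrier; _≈_; _+_; _*_; 0#; 1#)
  field
    1≉0       : ¬ (1# ≈ 0#)
    inverse   : ∀ x → ¬ (x ≈ 0#) → ∃ λ y → x * y ≈ 1#
    size      : ℕ
    enum      : Fin size → Carrier
    enum-surj : ∀ x → ∃ λ i → enum i ≈ x

module _ {c ℓ : Level} (F : CommutativeRing c ℓ) where
  open CommutativeRing F using (Carrier; _≈_; _+_; _*_; 0#; 1#)

  record IsSubgroupOfUnits {a : Level} (A : Carrier → Set a) : Set (c ⊔ ℓ ⊔ a) where
    field
      respects : ∀ {x y} → x ≈ y → A x → A y
      nonzero  : ∀ {x} → A x → ¬ (x ≈ 0#)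
      one      : A 1#
      mul      : ∀ {x y} → A x → A y → A (x * y)
      inv      : ∀ {x y} → A x → x * y ≈ 1# → A y

  IsProper : {a : Level} → (Carrier → Set a) → Set (c ⊔ ℓ ⊔ a)
  IsProper A = ∃ λ g → ¬ (g ≈ 0#) × ¬ A g

  sumF : (k : ℕ) → (Fin k → Carrier) → Carrier
  sumF zero    f = 0#
  sumF (suc k) f = f zero + sumF k (λ i → f (suc i))

  sumOver : (k : ℕ) → Subset k → (Fin k → Carrier) → Carrier
  sumOver zero    I f = 0#
  sumOver (suc k) (inside ∷ I) f = f zero + sumOver k I (λ i → f (suc i))
  sumOver (suc k) (outside ∷ I) f = sumOver k I (λ i → f (suc i))

  HasWeightedZeroSum : {a : Level} → (Carrier → Set a) → (k : ℕ) → (Fin k → Carrier) → Set (c ⊔ ℓ ⊔ a)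
  HasWeightedZeroSum A k x =
    Σ (Subset k) λ I → Nonempty I ×
      (Σ (Fin k → Carrier) λ w → (∀ i → i ∈ I → A (w i)) × (sumOver k I (λ i → w i * x i) ≈ 0#))

  AllHaveWeightedZeroSum : {a : Level} → (Carrier → Set a) → ℕ → Set (c ⊔ ℓ ⊔ a)
  AllHaveWeightedZeroSum A k = (x : Fin k → Carrier) → HasWeightedZeroSum A k x

  IsDavenportConstant : {a : Level} → (Carrier → Set a) → ℕ → Set (c ⊔ ℓ ⊔ a)
  IsDavenportConstant A D =
    1 ≤ D × AllHaveWeightedZeroSum A D × (∀ k → 1 ≤ k → AllHaveWeightedZeroSum A k → D ≤ k)

{-# OPTIONS --safe #-}
-- A sequence of length one, or a sequence (g, -1) with g ∉ A, has no A-weighted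
-- zero-sum subsequence: a single weighted term a·x is a product of nonzero field
-- elements, and a·g - b = 0 with a, b ∈ A would put g = a⁻¹b into the subgroup A.
module Submission where

open import Defs
open import Level using (Level)
open import Data.Nat using (ℕ; _≤_; suc; s≤s; z≤n)
open import Data.Fin using (zero; suc)
open import Data.Fin.Subset using (inside; outside)
open import Data.Vec using ([]; _∷_; lookup; here; there)
open import Data.Product using (_,_)
open import Data.Empty using (⊥-elim)
open import Relation.Nullary using (¬_)
open import Algebra.Bundles using (CommutativeRing)
import Algebra.Properties.Group as GroupProperties
import Algebra.Properties.Ring as RingProperties
import Relation.Binary.Reasoning.Setoid as SetoidReasoning

module UnitProperties {c ℓ : Level} (F : CommutativeRing c ℓ) where
  open CommutativeRing F hiding (zero)
  open GroupProperties +-group using (ε⁻¹≈ε; ⁻¹-injective)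
  open SetoidReasoning setoid

  unit-*-cancelʳ-0 : ∀ {x y y⁻¹} → y * y⁻¹ ≈ 1# → x * y ≈ 0# → x ≈ 0#
  unit-*-cancelʳ-0 {x} {y} {y⁻¹} yy⁻¹≈1 xy≈0 = begin
    x              ≈⟨ *-identityʳ x ⟨
    x * 1#         ≈⟨ *-congˡ yy⁻¹≈1 ⟨
    x * (y * y⁻¹)  ≈⟨ *-assoc x y y⁻¹ ⟨
    (x * y) * y⁻¹  ≈⟨ *-congʳ xy≈0 ⟩
    0# * y⁻¹       ≈⟨ zeroˡ y⁻¹ ⟩
    0#             ∎

  -1≉0 : ¬ (1# ≈ 0#) → ¬ (- 1# ≈ 0#)
  -1≉0 1≉0 -1≈0 = 1≉0 (⁻¹-injective (trans -1≈0 (sym ε⁻¹≈ε)))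

module WeightedZeroSums {c ℓ a : Level} (F : CommutativeRing c ℓ) (FF : IsFiniteField F)
    (A : CommutativeRing.Carrier F → Set a) (SG : IsSubgroupOfUnits F A) where
  open CommutativeRing F hiding (zero)
  open IsFiniteField FF
  open IsSubgroupOfUnits SG
  open UnitProperties F
  open GroupProperties +-group using (x∙y⁻¹≈ε⇒x≈y)
  open RingProperties ring using (-‿distribʳ-*)
  open SetoidReasoning setoid

  *-≉0 : ∀ {x y} → ¬ (x ≈ 0#) → ¬ (y ≈ 0#) → ¬ (x * y ≈ 0#)
  *-≉0 {y = y} x≉0 y≉0 xy≈0 with inverse y y≉0
  ... | _ , yy⁻¹≈1 = x≉0 (unit-*-cancelʳ-0 yy⁻¹≈1 xy≈0)

  weighted-term≉0 : ∀ {w x} → A w → ¬ (x ≈ 0#) → ¬ (w * x + 0# ≈ 0#)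
  weighted-term≉0 w∈A x≉0 e = *-≉0 (nonzero w∈A) x≉0 (trans (sym (+-identityʳ _)) e)

  ∈-quotient : ∀ {u v x} → A u → A v → u * x ≈ v → A x
  ∈-quotient {u} {v} {x} u∈A v∈A ux≈v with inverse u (nonzero u∈A)
  ... | u⁻¹ , uu⁻¹≈1 = respects u⁻¹v≈x (mul (inv u∈A uu⁻¹≈1) v∈A)
    where
    u⁻¹v≈x : u⁻¹ * v ≈ x
    u⁻¹v≈x = begin
      u⁻¹ * v        ≈⟨ *-congˡ ux≈v ⟨
      u⁻¹ * (u * x)  ≈⟨ *-assoc u⁻¹ u x ⟨
      (u⁻¹ * u) * x  ≈⟨ *-congʳ (trans (*-comm u⁻¹ u) uu⁻¹≈1) ⟩
      1# * x         ≈⟨ *-identityˡ x ⟩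
      x              ∎

  ¬zeroSum[x] : ∀ {x} → ¬ (x ≈ 0#) → ¬ HasWeightedZeroSum F A 1 (lookup (x ∷ []))
  ¬zeroSum[x] x≉0 (outside ∷ [] , (zero , ()) , _)
  ¬zeroSum[x] x≉0 (inside ∷ [] , _ , w , w∈A , e) = weighted-term≉0 (w∈A zero here) x≉0 e

  ¬zeroSum[g,-1] : ∀ {g} → ¬ (g ≈ 0#) → ¬ A g →
                   ¬ HasWeightedZeroSum F A 2 (lookup (g ∷ - 1# ∷ []))
  ¬zeroSum[g,-1] g≉0 g∉A (outside ∷ outside ∷ [] , (zero , ()) , _)
  ¬zeroSum[g,-1] g≉0 g∉A (outside ∷ outside ∷ [] , (suc zero , there ()) , _)
  ¬zeroSum[g,-1] g≉0 g∉A (inside ∷ outside ∷ [] , _ , w , w∈A , e) =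
    weighted-term≉0 (w∈A zero here) g≉0 e
  ¬zeroSum[g,-1] g≉0 g∉A (outside ∷ inside ∷ [] , _ , w , w∈A , e) =
    weighted-term≉0 (w∈A (suc zero) (there here)) (-1≉0 1≉0) e
  ¬zeroSum[g,-1] {g} g≉0 g∉A (inside ∷ inside ∷ [] , _ , w , w∈A , e) =
    g∉A (∈-quotient (w∈A zero here) (w∈A (suc zero) (there here)) (x∙y⁻¹≈ε⇒x≈y _ _ w₀g-w₁≈0))
    where
    w₀g-w₁≈0 : w zero * g + - w (suc zero) ≈ 0#
    w₀g-w₁≈0 = begin
      w zero * g + - w (suc zero)                 ≈⟨ +-congˡ (-‿cong (*-identityʳ _)) ⟨
      w zero * g + - (w (suc zero) * 1#)          ≈⟨ +-congˡ (-‿distribʳ-* _ 1#) ⟩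
      w zero * g + w (suc zero) * - 1#            ≈⟨ +-congˡ (+-identityʳ _) ⟨
      w zero * g + (w (suc zero) * - 1# + 0#)     ≈⟨ e ⟩
      0#                                          ∎

mainTheorem18 : {c ℓ a : Level} (F : CommutativeRing c ℓ) → IsFiniteField F →
    (A : CommutativeRing.Carrier F → Set a) → IsSubgroupOfUnits F A → IsProper F A →
    (D : ℕ) → IsDavenportConstant F A D → 3 ≤ D
mainTheorem18 F FF A SG (g , g≉0 , g∉A) D (1≤D , D-zeroSums , _) = 3≤D D 1≤D D-zeroSums
  where
  open WeightedZeroSums F FF A SG
  open IsFiniteField FF using (1≉0)

  3≤D : ∀ k → 1 ≤ k → AllHaveWeightedZeroSum F A k → 3 ≤ k
  3≤D 0 () _
  3≤D 1 _ zeroSums = ⊥-elim (¬zeroSum[x] 1≉0 (zeroSums _))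
  3≤D 2 _ zeroSums = ⊥-elim (¬zeroSum[g,-1] g≉0 g∉A (zeroSums _))
  3≤D (suc (suc (suc _))) _ _ = s≤s (s≤s (s≤s z≤n))
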